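{- Let $H$ be a nontrivial permutation group on a finite set $\Omega$ and let $G$ be a finite group. If $G=B\ltimes A$ (with $A\trianglelefteq G$), where $A$ is abelian of exponent greater than $2$, then $G\wr_\Omega H$ is non-CCA.
   Context: $G\wr_\Omega H=G^\Omega\rtimes H$ with $H$ permuting coordinates. For a group $G$ and inverse-closed $S\subseteq G$, $\mathrm{Cay}(G,S)$ is the edge-coloured graph on $G$ with edges $\{g,sg\}$ ($g\in G,s\in S$) coloured $\{s,s^{ -1}\}$. $\mathrm{Aut}_c$ is the group of colour-preserving graph automorphisms, $G_R$ the right regular representation, $\mathrm{Aut}_{\pm1}(G,S)=\{\alpha\in\mathrm{Aut}(G)\colon s^\alpha\in\{s,s^{ -1}\}\ \forall s\in S\}$. $\mathrm{Cay}(G,S)$ is CCA if $\mathrm{Aut}_c(\mathrm{Cay}(G,S))=G_R\rtimes\mathrm{Aut}_{\pm1}(G,S)$. A group is CCA if every connected Cayley graph on it is CCA, and non-CCA otherwise. -}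

module Defs where

open import Level using (0ℓ)
open import Data.Nat using (ℕ; zero; suc; _≤_)
open import Data.Fin using (Fin)
open import Data.Fin.Permutation using (Permutation′; _⟨$⟩ʳ_; _⟨$⟩ˡ_; _∘ₚ_; flip; id)
open import Data.List using (List; foldr)
open import Data.List.Relation.Unary.All using (All)
open import Data.Product using (Σ; ∃; _×_; _,_; proj₁)
open import Data.Sum using (_⊎_)
open import Relation.Nullary using (¬_)
open import Relation.Binary.PropositionalEquality using (_≡_)
open import Algebra.Bundles using (Group)
open import Algebra.Bundles.Raw using (RawGroup)

module _ (G : Group 0ℓ 0ℓ) where
  open Group G

  FiniteGroup : Set
  FiniteGroup = Σ ℕ λ m → Σ (Fin m → Carrier) λ e → ∀ x → ∃ λ i → x ≈ e i

  record Subgroup : Set₁ where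
    field
      member    : Carrier → Set
      respects  : ∀ {x y} → x ≈ y → member x → member y
      ε-closed  : member ε
      ∙-closed  : ∀ {x y} → member x → member y → member (x ∙ y)
      ⁻¹-closed : ∀ {x} → member x → member (x ⁻¹)

  open Subgroup

  IsNormal : Subgroup → Set
  IsNormal A = ∀ g {a} → member A a → member A (g ∙ a ∙ g ⁻¹)

  -- G is the internal semidirect product B ⋉ A  (A normal is assumed separately):
  -- G = BA and B ∩ A = 1
  IsSemidirect : Subgroup → Subgroup → Set
  IsSemidirect B A =
    (∀ g → ∃ λ b → ∃ λ a → member B b × member A a × g ≈ b ∙ a)
    × (∀ {x} → member B x → member A x → x ≈ ε)

  IsAbelianSub : Subgroup → Set
  IsAbelianSub A = ∀ {x y} → member A x → member A y → x ∙ y ≈ y ∙ x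

  pow : Carrier → ℕ → Carrier
  pow x zero    = ε
  pow x (suc k) = x ∙ pow x k

  Annihilates : Subgroup → ℕ → Set
  Annihilates A e = ∀ {a} → member A a → pow a e ≈ ε

  -- exponent(A) > 2: no positive e ≤ 2 annihilates A
  -- (the exponent being the least positive annihilating e)
  ExponentGreaterThan2 : Subgroup → Set
  ExponentGreaterThan2 A = ∀ e → 1 ≤ e → e ≤ 2 → ¬ Annihilates A e

record PermGroup (n : ℕ) : Set₁ where
  field
    member    : Permutation′ n → Set
    respects  : ∀ {π ρ} → (∀ i → π ⟨$⟩ʳ i ≡ ρ ⟨$⟩ʳ i) → member π → member ρ
    id-closed : member id
    ∘-closed  : ∀ {π ρ} → member π → member ρ → member (π ∘ₚ ρ)
    inv-closed : ∀ {π} → member π → member (flip π)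

Nontrivial : ∀ {n} → PermGroup n → Set
Nontrivial {n} H = ¬ (∀ π → PermGroup.member H π → ∀ (i : Fin n) → π ⟨$⟩ʳ i ≡ i)

-- Wreath product  G ≀_Ω H = G^Ω ⋊ H   (Ω = Fin n)
-- elements (f , h); h acts on G^Ω by (h·f)(ω) = f(h⁻¹ ω);
-- (f , h)(f' , h') = (f · (h·f') , h h')   where (h h')(ω) = h(h'(ω)).

Wreath : (G : Group 0ℓ 0ℓ) → ∀ {n} → PermGroup n → RawGroup 0ℓ 0ℓ
Wreath G {n} H = record
  { Carrier = (Fin n → G.Carrier) × Σ (Permutation′ n) H.member
  ; _≈_ = λ { (f , (h , _)) (f' , (h' , _)) →
              (∀ ω → f ω G.≈ f' ω) × (∀ ω → h ⟨$⟩ʳ ω ≡ h' ⟨$⟩ʳ ω) }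
  ; _∙_ = λ { (f , (h , p)) (f' , (h' , p')) →
              (λ ω → f ω G.∙ f' (h ⟨$⟩ˡ ω)) , (h' ∘ₚ h , H.∘-closed p' p) }
  ; ε = (λ _ → G.ε) , (id , H.id-closed)
  ; _⁻¹ = λ { (f , (h , p)) → (λ ω → f (h ⟨$⟩ʳ ω) G.⁻¹) , (flip h , H.inv-closed p) }
  }
  where
    module G = Group G
    module H = PermGroup H

module _ (W : RawGroup 0ℓ 0ℓ) where
  open RawGroup W

  record Perm : Set where
    field
      to       : Carrier → Carrier
      from     : Carrier → Carrier
      to-cong  : ∀ {x y} → x ≈ y → to x ≈ to y
      from-cong : ∀ {x y} → x ≈ y → from x ≈ from y
      to-from  : ∀ x → to (from x) ≈ x
      from-to  : ∀ x → from (to x) ≈ x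

  module _ (S : Carrier → Set) where

    RespectsS : Set
    RespectsS = ∀ {x y} → x ≈ y → S x → S y

    InverseClosed : Set
    InverseClosed = ∀ {s} → S s → S (s ⁻¹)

    -- Cay(W,S) connected: S generates W
    Generates : Set
    Generates = ∀ x → ∃ λ (ws : List Carrier) → All S ws × x ≈ foldr _∙_ ε ws

    -- f maps every edge {g, s g} (colour {s,s⁻¹}) to an edge of colour {s,s⁻¹}
    PreservesColouredEdges : (Carrier → Carrier) → Set
    PreservesColouredEdges f =
      ∀ g {s} → S s → (f (s ∙ g) ≈ s ∙ f g) ⊎ (f (s ∙ g) ≈ (s ⁻¹) ∙ f g)

    InAutc : Perm → Set
    InAutc φ = PreservesColouredEdges (Perm.to φ) × PreservesColouredEdges (Perm.from φ)

    IsAut : (Carrier → Carrier) → Set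
    IsAut α = Σ Perm λ π → (∀ x → Perm.to π x ≈ α x)
              × (∀ x y → α (x ∙ y) ≈ α x ∙ α y)

    InAutPm1 : (Carrier → Carrier) → Set
    InAutPm1 α = IsAut α × (∀ {s} → S s → (α s ≈ s) ⊎ (α s ≈ s ⁻¹))

    -- φ ∈ W_R ⋊ Aut_{±1}(W,S):  φ(x) = α(x) g
    InGRAut : Perm → Set
    InGRAut φ = ∃ λ α → InAutPm1 α × ∃ λ g → ∀ x → Perm.to φ x ≈ α x ∙ g

    CayIsCCA : Set
    CayIsCCA = ∀ φ → (InAutc φ → InGRAut φ) × (InGRAut φ → InAutc φ)

  IsCCAGroup : Set₁
  IsCCAGroup = ∀ (S : Carrier → Set) → RespectsS S → InverseClosed S → Generates S → CayIsCCA S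

  NonCCA : Set₁
  NonCCA = ¬ IsCCAGroup

-- Since A is abelian and normal, τ (b a) = b a⁻¹ is an automorphism of G
-- fixing B and inverting A.  Let S ⊆ G ≀ H consist of B^Ω ⋊ H and the elements of A^Ω
-- supported on one coordinate; S generates.  For ω₀ ∈ Ω let φ apply τ to the coordinate
-- h(ω₀) of (f , h).  Left multiplication by s ∈ S moves that coordinate along with the
-- permutation, so φ maps every s-coloured edge to an edge coloured s or s⁻¹; as φ also
-- fixes the identity, a CCA Cayley graph would force φ to be a group automorphism.  But if
-- h ∈ H moves ω₀, then φ((a , 1)(1 , h)) and φ(a , 1) φ(1 , h) differ at ω₀ by a ↦ a⁻¹
-- for every a ∈ A, so A would have exponent at most 2.

module Submission where

open import Defs
open import Level using (0ℓ)
open import Data.Nat using (ℕ; zero; suc; s≤s; z≤n)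
open import Algebra.Bundles using (Group)
open import Algebra.Bundles.Raw using (RawGroup)
open import Algebra.Structures using (IsGroup)
open import Data.Fin using (Fin; zero; suc; _≟_)
open import Data.Fin.Properties using (suc-injective; 0≢1+n)
open import Data.Fin.Permutation as Perm using (Permutation′; _⟨$⟩ʳ_; _⟨$⟩ˡ_)
  renaming (_≈_ to _≈ₚ_)
open import Data.Product using (∃; _×_; _,_; proj₁; proj₂)
open import Data.Empty using (⊥-elim)
open import Data.Sum using (_⊎_; inj₁; inj₂)
open import Data.List using (List; []; _∷_; foldr)
open import Data.List.Relation.Unary.All using (All; []; _∷_)
open import Function using (_∘_; id; Injective)
open import Relation.Nullary using (yes; no; contradiction)
open import Relation.Binary.Structures using (IsEquivalence)
open import Relation.Binary.PropositionalEquality as ≡ using (_≡_; _≢_)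
import Algebra.Properties.Group as GroupProperties
import Relation.Binary.Reasoning.Setoid as SetoidReasoning

module ComplementInversion
  (G : Group 0ℓ 0ℓ) (A B : Subgroup G)
  (A◁G : IsNormal G A) (G≈B⋉A : IsSemidirect G B A) (A-comm : IsAbelianSub G A)
  where

  open Group G
  open GroupProperties G
  open SetoidReasoning setoid
  private
    module A = Subgroup A
    module B = Subgroup B

  factorisation-unique : ∀ {b a b′ a′} → B.member b → A.member a → B.member b′ → A.member a′
                       → b ∙ a ≈ b′ ∙ a′ → b ≈ b′ × a ≈ a′
  factorisation-unique {b} {a} {b′} {a′} b∈B a∈A b′∈B a′∈A ba≈b′a′ =
    b≈b′ , ∙-cancelˡ b a a′ (trans ba≈b′a′ (∙-congʳ (sym b≈b′)))
    where
    b′\\b≈a′//a : b′ \\ b ≈ a′ // a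
    b′\\b≈a′//a = x≈z//y (b′ \\ b) a a′ (begin
      (b′ \\ b) ∙ a    ≈⟨ assoc (b′ ⁻¹) b a ⟩
      b′ \\ (b ∙ a)    ≈⟨ ∙-congˡ ba≈b′a′ ⟩
      b′ \\ (b′ ∙ a′)  ≈⟨ \\-leftDividesʳ b′ a′ ⟩
      a′               ∎)
    b≈b′ : b ≈ b′
    b≈b′ = trans (inverseʳ-unique (b′ ⁻¹) b (proj₂ G≈B⋉A
                   (B.∙-closed (B.⁻¹-closed b′∈B) b∈B)
                   (A.respects (sym b′\\b≈a′//a) (A.∙-closed a′∈A (A.⁻¹-closed a∈A)))))
                 (⁻¹-involutive b′)

  bpart apart : Carrier → Carrier
  bpart x = proj₁ (proj₁ G≈B⋉A x)
  apart x = proj₁ (proj₂ (proj₁ G≈B⋉A x))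

  bpart∈B : ∀ x → B.member (bpart x)
  bpart∈B x = proj₁ (proj₂ (proj₂ (proj₁ G≈B⋉A x)))

  apart∈A : ∀ x → A.member (apart x)
  apart∈A x = proj₁ (proj₂ (proj₂ (proj₂ (proj₁ G≈B⋉A x))))

  bpart∙apart : ∀ x → x ≈ bpart x ∙ apart x
  bpart∙apart x = proj₂ (proj₂ (proj₂ (proj₂ (proj₁ G≈B⋉A x))))

  invert : Carrier → Carrier
  invert x = bpart x ∙ apart x ⁻¹

  invert-factor : ∀ {x b a} → B.member b → A.member a → x ≈ b ∙ a → invert x ≈ b ∙ a ⁻¹
  invert-factor {x} b∈B a∈A x≈ba =
    let b≈ , a≈ = factorisation-unique (bpart∈B x) (apart∈A x) b∈B a∈A (trans (sym (bpart∙apart x)) x≈ba)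
    in ∙-cong b≈ (⁻¹-cong a≈)

  invert-cong : ∀ {x y} → x ≈ y → invert x ≈ invert y
  invert-cong {x} {y} x≈y = invert-factor (bpart∈B y) (apart∈A y) (trans x≈y (bpart∙apart y))

  invert-fixes-B : ∀ {b} → B.member b → invert b ≈ b
  invert-fixes-B {b} b∈B = begin
    invert b   ≈⟨ invert-factor b∈B A.ε-closed (sym (identityʳ b)) ⟩
    b ∙ ε ⁻¹   ≈⟨ ∙-congˡ ε⁻¹≈ε ⟩
    b ∙ ε      ≈⟨ identityʳ b ⟩
    b          ∎

  invert-inverts-A : ∀ {a} → A.member a → invert a ≈ a ⁻¹
  invert-inverts-A {a} a∈A =
    trans (invert-factor B.ε-closed a∈A (sym (identityˡ a))) (identityˡ (a ⁻¹))

  invert-ε : invert ε ≈ ε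
  invert-ε = invert-fixes-B B.ε-closed

  invert-involutive : ∀ x → invert (invert x) ≈ x
  invert-involutive x = begin
    invert (invert x)        ≈⟨ invert-factor (bpart∈B x) (A.⁻¹-closed (apart∈A x)) refl ⟩
    bpart x ∙ apart x ⁻¹ ⁻¹  ≈⟨ ∙-congˡ (⁻¹-involutive (apart x)) ⟩
    bpart x ∙ apart x        ≈⟨ bpart∙apart x ⟨
    x                        ∎

  invert-∙ : ∀ x y → invert (x ∙ y) ≈ invert x ∙ invert y
  invert-∙ x y = begin
    invert (x ∙ y)                  ≈⟨ invert-factor (B.∙-closed (bpart∈B x) (bpart∈B y)) (A.∙-closed c∈A (apart∈A y)) xy≈ ⟩
    b ∙ b′ ∙ (c ∙ a′) ⁻¹            ≈⟨ ∙-congˡ (⁻¹-anti-homo-∙ c a′) ⟩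
    b ∙ b′ ∙ (a′ ⁻¹ ∙ c ⁻¹)         ≈⟨ ∙-congˡ (A-comm (A.⁻¹-closed (apart∈A y)) (A.⁻¹-closed c∈A)) ⟩
    b ∙ b′ ∙ (c ⁻¹ ∙ a′ ⁻¹)         ≈⟨ assoc b b′ _ ⟩
    b ∙ (b′ ∙ (c ⁻¹ ∙ a′ ⁻¹))       ≈⟨ ∙-congˡ (assoc b′ (c ⁻¹) (a′ ⁻¹)) ⟨
    b ∙ (b′ ∙ c ⁻¹ ∙ a′ ⁻¹)         ≈⟨ ∙-congˡ (∙-congʳ b′c⁻¹≈a⁻¹b′) ⟩
    b ∙ (a ⁻¹ ∙ b′ ∙ a′ ⁻¹)         ≈⟨ ∙-congˡ (assoc (a ⁻¹) b′ (a′ ⁻¹)) ⟩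
    b ∙ (a ⁻¹ ∙ (b′ ∙ a′ ⁻¹))       ≈⟨ assoc b (a ⁻¹) _ ⟨
    b ∙ a ⁻¹ ∙ (b′ ∙ a′ ⁻¹)         ∎
    where
    b = bpart x
    a = apart x
    b′ = bpart y
    a′ = apart y
    -- a b′ = b′ c:  moving b′ to the left conjugates a into c, which lies in A by normality
    c = b′ \\ (a ∙ b′)
    c∈A : A.member c
    c∈A = A.respects (trans (assoc (b′ ⁻¹) a (b′ ⁻¹ ⁻¹)) (∙-congˡ (∙-congˡ (⁻¹-involutive b′))))
                     (A◁G (b′ ⁻¹) (apart∈A x))
    b′c⁻¹≈a⁻¹b′ : b′ ∙ c ⁻¹ ≈ a ⁻¹ ∙ b′
    b′c⁻¹≈a⁻¹b′ = begin
      b′ ∙ (b′ ⁻¹ ∙ (a ∙ b′)) ⁻¹        ≈⟨ ∙-congˡ (⁻¹-anti-homo-∙ (b′ ⁻¹) (a ∙ b′)) ⟩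
      b′ ∙ ((a ∙ b′) ⁻¹ ∙ b′ ⁻¹ ⁻¹)     ≈⟨ ∙-congˡ (∙-cong (⁻¹-anti-homo-∙ a b′) (⁻¹-involutive b′)) ⟩
      b′ ∙ (b′ ⁻¹ ∙ a ⁻¹ ∙ b′)          ≈⟨ ∙-congˡ (assoc (b′ ⁻¹) (a ⁻¹) b′) ⟩
      b′ ∙ (b′ \\ (a ⁻¹ ∙ b′))          ≈⟨ \\-leftDividesˡ b′ (a ⁻¹ ∙ b′) ⟩
      a ⁻¹ ∙ b′                         ∎
    xy≈ : x ∙ y ≈ b ∙ b′ ∙ (c ∙ a′)
    xy≈ = begin
      x ∙ y                   ≈⟨ ∙-cong (bpart∙apart x) (bpart∙apart y) ⟩
      b ∙ a ∙ (b′ ∙ a′)       ≈⟨ assoc b a _ ⟩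
      b ∙ (a ∙ (b′ ∙ a′))     ≈⟨ ∙-congˡ (assoc a b′ a′) ⟨
      b ∙ (a ∙ b′ ∙ a′)       ≈⟨ ∙-congˡ (∙-congʳ (\\-leftDividesˡ b′ (a ∙ b′))) ⟨
      b ∙ (b′ ∙ c ∙ a′)       ≈⟨ ∙-congˡ (assoc b′ c a′) ⟩
      b ∙ (b′ ∙ (c ∙ a′))     ≈⟨ assoc b b′ _ ⟨
      b ∙ b′ ∙ (c ∙ a′)       ∎

⟨$⟩ˡ-cong : ∀ {n} (π ρ : Permutation′ n) → π ≈ₚ ρ → ∀ i → π ⟨$⟩ˡ i ≡ ρ ⟨$⟩ˡ i
⟨$⟩ˡ-cong π ρ π≈ρ i = ≡.trans (≡.sym (Perm.inverseˡ ρ))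
                             (≡.cong (ρ ⟨$⟩ˡ_) (≡.trans (≡.sym (π≈ρ (π ⟨$⟩ˡ i))) (Perm.inverseʳ π)))

module _ (G : Group 0ℓ 0ℓ) {n : ℕ} (H : PermGroup n) where
  private
    module G = Group G
    module W = RawGroup (Wreath G H)

  wreath-isEquivalence : IsEquivalence W._≈_
  wreath-isEquivalence = record
    { refl = (λ _ → G.refl) , (λ _ → ≡.refl)
    ; sym = λ (f≈ , h≈) → (λ ω → G.sym (f≈ ω)) , (λ ω → ≡.sym (h≈ ω))
    ; trans = λ (f≈ , h≈) (f≈′ , h≈′) → (λ ω → G.trans (f≈ ω) (f≈′ ω)) , (λ ω → ≡.trans (h≈ ω) (h≈′ ω))
    }

  wreath-∙-cong : ∀ {x x′ y y′} → x W.≈ x′ → y W.≈ y′ → (x W.∙ y) W.≈ (x′ W.∙ y′)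
  wreath-∙-cong {f , h , _} {f′ , h′ , _} {g , k , _} {g′ , k′ , _} (f≈ , h≈) (g≈ , k≈) =
    (λ ω → G.∙-cong (f≈ ω) (G.trans (g≈ (h ⟨$⟩ˡ ω)) (G.reflexive (≡.cong g′ (⟨$⟩ˡ-cong h h′ h≈ ω))))) ,
    (λ ω → ≡.trans (≡.cong (h ⟨$⟩ʳ_) (k≈ ω)) (h≈ (k′ ⟨$⟩ʳ ω)))

  wreath-⁻¹-cong : ∀ {x y} → x W.≈ y → (x W.⁻¹) W.≈ (y W.⁻¹)
  wreath-⁻¹-cong {f , h , _} {f′ , h′ , _} (f≈ , h≈) =
    (λ ω → G.⁻¹-cong (G.trans (f≈ (h ⟨$⟩ʳ ω)) (G.reflexive (≡.cong f′ (h≈ ω))))) ,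
    ⟨$⟩ˡ-cong h h′ h≈

  wreath-inverseʳ : ∀ x → (x W.∙ x W.⁻¹) W.≈ W.ε
  wreath-inverseʳ (f , h , _) =
    (λ ω → G.trans (G.∙-congˡ (G.⁻¹-cong (G.reflexive (≡.cong f (Perm.inverseʳ h))))) (G.inverseʳ (f ω))) ,
    (λ _ → Perm.inverseʳ h)

  wreath-isGroup : IsGroup W._≈_ W._∙_ W.ε W._⁻¹
  wreath-isGroup = record
    { isMonoid = record
      { isSemigroup = record
        { isMagma = record { isEquivalence = wreath-isEquivalence ; ∙-cong = λ {x} {x′} {y} {y′} → wreath-∙-cong {x} {x′} {y} {y′} }
        ; assoc = λ _ _ _ → (λ _ → G.assoc _ _ _) , (λ _ → ≡.refl)
        }
      ; identity = (λ _ → (λ _ → G.identityˡ _) , (λ _ → ≡.refl))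
                 , (λ _ → (λ _ → G.identityʳ _) , (λ _ → ≡.refl))
      }
    ; inverse = (λ { (f , h , _) → (λ ω → G.inverseˡ (f (h ⟨$⟩ʳ ω))) , (λ _ → Perm.inverseˡ h) })
              , wreath-inverseʳ
    ; ⁻¹-cong = λ {x} {y} → wreath-⁻¹-cong {x} {y}
    }

  wreathGroup : Group 0ℓ 0ℓ
  wreathGroup = record { isGroup = wreath-isGroup }

module _ (W : Group 0ℓ 0ℓ) where
  open Group W
  open GroupProperties W
  open SetoidReasoning setoid

  inGRAut∧fixes-ε⇒homomorphic : ∀ {S} (Φ : Perm rawGroup) → InGRAut rawGroup S Φ → Perm.to Φ ε ≈ ε
                              → ∀ x y → Perm.to Φ (x ∙ y) ≈ Perm.to Φ x ∙ Perm.to Φ y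
  inGRAut∧fixes-ε⇒homomorphic Φ (α , ((π , π≈α , α-hom) , _) , g , φ≈α∙g) φε≈ε x y = begin
    φ (x ∙ y)     ≈⟨ φ≈α (x ∙ y) ⟩
    α (x ∙ y)     ≈⟨ α-hom x y ⟩
    α x ∙ α y     ≈⟨ ∙-cong (φ≈α x) (φ≈α y) ⟨
    φ x ∙ φ y     ∎
    where
    φ : Carrier → Carrier
    φ = Perm.to Φ
    α-cong : ∀ {x y} → x ≈ y → α x ≈ α y
    α-cong {x} {y} x≈y = trans (sym (π≈α x)) (trans (Perm.to-cong π x≈y) (π≈α y))
    αε≈ε : α ε ≈ ε
    αε≈ε = identityˡ-unique (α ε) (α ε) (trans (sym (α-hom ε ε)) (α-cong (identityˡ ε)))
    g≈ε : g ≈ ε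
    g≈ε = begin
      g          ≈⟨ identityˡ g ⟨
      ε ∙ g      ≈⟨ ∙-congʳ αε≈ε ⟨
      α ε ∙ g    ≈⟨ φ≈α∙g ε ⟨
      φ ε        ≈⟨ φε≈ε ⟩
      ε          ∎
    φ≈α : ∀ x → φ x ≈ α x
    φ≈α x = trans (φ≈α∙g x) (trans (∙-congˡ g≈ε) (identityʳ (α x)))

module WreathTwist
  {n : ℕ} (H : PermGroup n) (G : Group 0ℓ 0ℓ) (A B : Subgroup G)
  (A◁G : IsNormal G A) (G≈B⋉A : IsSemidirect G B A) (A-comm : IsAbelianSub G A)
  where

  open Group G
  open GroupProperties G using (ε⁻¹≈ε)
  open ComplementInversion G A B A◁G G≈B⋉A A-comm
  private
    module A = Subgroup A
    module B = Subgroup B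
    module H = PermGroup H
    W = wreathGroup G H
    module W = Group W

  fn : W.Carrier → Fin n → Carrier
  fn = proj₁

  perm : W.Carrier → Permutation′ n
  perm x = proj₁ (proj₂ x)

  invertAt : Fin n → Fin n → Carrier → Carrier
  invertAt c ω x with ω ≟ c
  ... | yes _ = invert x
  ... | no _ = x

  invertAt-cong : ∀ c ω {x y} → x ≈ y → invertAt c ω x ≈ invertAt c ω y
  invertAt-cong c ω x≈y with ω ≟ c
  ... | yes _ = invert-cong x≈y
  ... | no _ = x≈y

  invertAt-∙ : ∀ c ω x y → invertAt c ω (x ∙ y) ≈ invertAt c ω x ∙ invertAt c ω y
  invertAt-∙ c ω x y with ω ≟ c
  ... | yes _ = invert-∙ x y
  ... | no _ = refl

  invertAt-involutive : ∀ c ω x → invertAt c ω (invertAt c ω x) ≈ x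
  invertAt-involutive c ω x with ω ≟ c
  ... | yes _ = invert-involutive x
  ... | no _ = refl

  invertAt-here : ∀ c ω x → ω ≡ c → invertAt c ω x ≈ invert x
  invertAt-here c ω x ω≡c with ω ≟ c
  ... | yes _ = refl
  ... | no ω≢c = contradiction ω≡c ω≢c

  invertAt-elsewhere : ∀ c ω x → ω ≢ c → invertAt c ω x ≈ x
  invertAt-elsewhere c ω x ω≢c with ω ≟ c
  ... | yes ω≡c = contradiction ω≡c ω≢c
  ... | no _ = refl

  invertAt-fixes : ∀ c ω {x} → (ω ≡ c → invert x ≈ x) → invertAt c ω x ≈ x
  invertAt-fixes c ω fixed with ω ≟ c
  ... | yes ω≡c = fixed ω≡c
  ... | no _ = refl

  invertAt-inverts : ∀ c ω {x} → (ω ≡ c → invert x ≈ x ⁻¹) → (ω ≢ c → x ≈ x ⁻¹) → invertAt c ω x ≈ x ⁻¹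
  invertAt-inverts c ω here elsewhere with ω ≟ c
  ... | yes ω≡c = here ω≡c
  ... | no ω≢c = elsewhere ω≢c

  invertAt-⟨$⟩ʳ : ∀ (σ : Permutation′ n) c ω x → invertAt (σ ⟨$⟩ʳ c) ω x ≈ invertAt c (σ ⟨$⟩ˡ ω) x
  invertAt-⟨$⟩ʳ σ c ω x with ω ≟ σ ⟨$⟩ʳ c | σ ⟨$⟩ˡ ω ≟ c
  ... | yes _ | yes _ = refl
  ... | no _ | no _ = refl
  ... | yes ω≡σc | no σ⁻¹ω≢c = contradiction (≡.trans (≡.cong (σ ⟨$⟩ˡ_) ω≡σc) (Perm.inverseˡ σ)) σ⁻¹ω≢c
  ... | no ω≢σc | yes σ⁻¹ω≡c = contradiction (≡.trans (≡.sym (Perm.inverseʳ σ)) (≡.cong (σ ⟨$⟩ʳ_) σ⁻¹ω≡c)) ω≢σc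

  invertCoord : Fin n → W.Carrier → W.Carrier
  invertCoord c (f , h) = (λ ω → invertAt c ω (f ω)) , h

  invertCoord-∙ : ∀ c s g → invertCoord (perm s ⟨$⟩ʳ c) (s W.∙ g) W.≈ invertCoord (perm s ⟨$⟩ʳ c) s W.∙ invertCoord c g
  invertCoord-∙ c (f , σ , _) (g , _) =
    (λ ω → trans (invertAt-∙ (σ ⟨$⟩ʳ c) ω (f ω) _) (∙-congˡ (invertAt-⟨$⟩ʳ σ c ω _))) , (λ _ → ≡.refl)

  twist : Fin n → W.Carrier → W.Carrier
  twist ω₀ x = invertCoord (perm x ⟨$⟩ʳ ω₀) x

  module _ (ω₀ : Fin n) where

    twist-involutive : ∀ x → twist ω₀ (twist ω₀ x) W.≈ x
    twist-involutive (f , _) = (λ ω → invertAt-involutive _ ω (f ω)) , (λ _ → ≡.refl)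

    twist-cong : ∀ {x y} → x W.≈ y → twist ω₀ x W.≈ twist ω₀ y
    twist-cong {_} {g , _} (f≈g , h≈k) =
      (λ ω → trans (invertAt-cong _ ω (f≈g ω)) (reflexive (≡.cong (λ c → invertAt c ω (g ω)) (h≈k ω₀)))) , h≈k

    twist-ε : twist ω₀ W.ε W.≈ W.ε
    twist-ε = (λ ω → invertAt-fixes ω₀ ω (λ _ → invert-ε)) , (λ _ → ≡.refl)

    twistPerm : Perm W.rawGroup
    twistPerm = record
      { to = twist ω₀ ; from = twist ω₀
      ; to-cong = λ {x} {y} → twist-cong {x} {y} ; from-cong = λ {x} {y} → twist-cong {x} {y}
      ; to-from = twist-involutive ; from-to = twist-involutive }

  SingleA : Fin n → W.Carrier → Set
  SingleA ω₁ x = A.member (fn x ω₁) × (∀ ω → ω ≢ ω₁ → fn x ω ≈ ε) × perm x ≈ₚ Perm.id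

  Connection : W.Carrier → Set
  Connection x = (∀ ω → B.member (fn x ω)) ⊎ ∃ λ ω₁ → SingleA ω₁ x

  connection-respects : RespectsS W.rawGroup Connection
  connection-respects (f≈ , _) (inj₁ f∈B) = inj₁ (λ ω → B.respects (f≈ ω) (f∈B ω))
  connection-respects (f≈ , h≈) (inj₂ (ω₁ , fω₁∈A , f≈ε , h≈id)) =
    inj₂ (ω₁ , A.respects (f≈ ω₁) fω₁∈A , (λ ω ω≢ω₁ → trans (sym (f≈ ω)) (f≈ε ω ω≢ω₁)) ,
          (λ i → ≡.trans (≡.sym (h≈ i)) (h≈id i)))

  connection-inverseClosed : InverseClosed W.rawGroup Connection
  connection-inverseClosed (inj₁ f∈B) = inj₁ (λ ω → B.⁻¹-closed (f∈B _))
  connection-inverseClosed {f , h , _} (inj₂ (ω₁ , fω₁∈A , f≈ε , h≈id)) =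
    inj₂ (ω₁ , A.⁻¹-closed (≡.subst (A.member ∘ f) (≡.sym (h≈id ω₁)) fω₁∈A) ,
          (λ ω ω≢ω₁ → trans (⁻¹-cong (trans (reflexive (≡.cong f (h≈id ω))) (f≈ε ω ω≢ω₁))) ε⁻¹≈ε) ,
          ⟨$⟩ˡ-cong h Perm.id h≈id)

  connection-invertCoord : ∀ {s} → Connection s → ∀ c → invertCoord c s W.≈ s ⊎ invertCoord c s W.≈ s W.⁻¹
  connection-invertCoord (inj₁ f∈B) c =
    inj₁ ((λ ω → invertAt-fixes c ω (λ _ → invert-fixes-B (f∈B ω))) , (λ _ → ≡.refl))
  connection-invertCoord {f , h , _} (inj₂ (ω₁ , fω₁∈A , f≈ε , h≈id)) c with ω₁ ≟ c
  ... | no ω₁≢c = inj₁ ((λ ω → invertAt-fixes c ω (λ ω≡c → invert-fixes-B (fω∈B ω ω≡c))) , (λ _ → ≡.refl))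
    where
    fω∈B : ∀ ω → ω ≡ c → B.member (f ω)
    fω∈B ω ω≡c = B.respects (sym (f≈ε ω (λ ω≡ω₁ → ω₁≢c (≡.trans (≡.sym ω≡ω₁) ω≡c)))) B.ε-closed
  ... | yes ω₁≡c =
    inj₂ ((λ ω → trans (invertAt-inverts c ω (here ω) (elsewhere ω)) (⁻¹-cong (reflexive (≡.cong f (≡.sym (h≈id ω)))))) ,
          (λ i → ≡.trans (h≈id i) (≡.sym (⟨$⟩ˡ-cong h Perm.id h≈id i))))
    where
    here : ∀ ω → ω ≡ c → invert (f ω) ≈ f ω ⁻¹
    here ω ω≡c = invert-inverts-A (≡.subst (A.member ∘ f) (≡.trans ω₁≡c (≡.sym ω≡c)) fω₁∈A)
    elsewhere : ∀ ω → ω ≢ c → f ω ≈ f ω ⁻¹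
    elsewhere ω ω≢c = let fω≈ε = f≈ε ω (λ ω≡ω₁ → ω≢c (≡.trans ω≡ω₁ ω₁≡c))
                      in trans fω≈ε (trans (sym ε⁻¹≈ε) (⁻¹-cong (sym fω≈ε)))

  twist-∙ : ∀ ω₀ s g {t} → invertCoord (perm s ⟨$⟩ʳ (perm g ⟨$⟩ʳ ω₀)) s W.≈ t → twist ω₀ (s W.∙ g) W.≈ t W.∙ twist ω₀ g
  twist-∙ ω₀ s g {t} ≈t = begin
    twist ω₀ (s W.∙ g)                                               ≈⟨ invertCoord-∙ (perm g ⟨$⟩ʳ ω₀) s g ⟩
    invertCoord (perm s ⟨$⟩ʳ (perm g ⟨$⟩ʳ ω₀)) s W.∙ twist ω₀ g     ≈⟨ W.∙-congʳ {twist ω₀ g} {invertCoord _ s} {t} ≈t ⟩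
    t W.∙ twist ω₀ g                                                 ∎
    where open SetoidReasoning W.setoid

  twist-preservesColouredEdges : ∀ ω₀ → PreservesColouredEdges W.rawGroup Connection (twist ω₀)
  twist-preservesColouredEdges ω₀ g {s} s∈C with connection-invertCoord {s} s∈C (perm s ⟨$⟩ʳ (perm g ⟨$⟩ʳ ω₀))
  ... | inj₁ fixed = inj₁ (twist-∙ ω₀ s g {s} fixed)
  ... | inj₂ inverted = inj₂ (twist-∙ ω₀ s g {s W.⁻¹} inverted)

  onlyAt : Fin n → Carrier → Fin n → Carrier
  onlyAt j v ω with ω ≟ j
  ... | yes _ = v
  ... | no _ = ε

  onlyAt-here : ∀ j v → onlyAt j v j ≈ v
  onlyAt-here j v with j ≟ j
  ... | yes _ = refl
  ... | no j≢j = contradiction ≡.refl j≢j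

  onlyAt-elsewhere : ∀ {j ω} v → ω ≢ j → onlyAt j v ω ≈ ε
  onlyAt-elsewhere {j} {ω} v ω≢j with ω ≟ j
  ... | yes ω≡j = contradiction ω≡j ω≢j
  ... | no _ = refl

  single : Fin n → Carrier → W.Carrier
  single j v = onlyAt j v , Perm.id , H.id-closed

  single-connection : ∀ j {v} → A.member v → Connection (single j v)
  single-connection j {v} v∈A = inj₂ (j , A.respects (sym (onlyAt-here j v)) v∈A , (λ ω → onlyAt-elsewhere v) , (λ _ → ≡.refl))

  ∏ : List W.Carrier → W.Carrier
  ∏ = foldr W._∙_ W.ε

  module _ (c : Fin n → Carrier) where

    singles : ∀ {m} → (Fin m → Fin n) → List W.Carrier
    singles {zero} ι = []
    singles {suc m} ι = single (ι zero) (c (ι zero)) ∷ singles (ι ∘ suc)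

    singles-connection : (∀ ω → A.member (c ω)) → ∀ {m} (ι : Fin m → Fin n) → All Connection (singles ι)
    singles-connection c∈A {zero} ι = []
    singles-connection c∈A {suc m} ι = single-connection (ι zero) (c∈A (ι zero)) ∷ singles-connection c∈A (ι ∘ suc)

    perm-∏singles : ∀ {m} (ι : Fin m → Fin n) → perm (∏ (singles ι)) ≈ₚ Perm.id
    perm-∏singles {zero} ι i = ≡.refl
    perm-∏singles {suc m} ι i = perm-∏singles (ι ∘ suc) i

    ∏singles-outside : ∀ {m} (ι : Fin m → Fin n) ω → (∀ i → ι i ≢ ω) → fn (∏ (singles ι)) ω ≈ ε
    ∏singles-outside {zero} ι ω ω∉ι = refl
    ∏singles-outside {suc m} ι ω ω∉ι =
      trans (∙-cong (onlyAt-elsewhere _ (λ ω≡ι0 → ω∉ι zero (≡.sym ω≡ι0)))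
                    (∏singles-outside (ι ∘ suc) ω (ω∉ι ∘ suc)))
            (identityˡ ε)

    ∏singles-inside : ∀ {m} (ι : Fin m → Fin n) → Injective _≡_ _≡_ ι → ∀ i → fn (∏ (singles ι)) (ι i) ≈ c (ι i)
    ∏singles-inside {suc m} ι ι-inj zero =
      trans (∙-cong (onlyAt-here (ι zero) _)
                    (∏singles-outside (ι ∘ suc) (ι zero) (λ i ιsi≡ι0 → 0≢1+n (ι-inj (≡.sym ιsi≡ι0)))))
            (identityʳ _)
    ∏singles-inside {suc m} ι ι-inj (suc i) =
      trans (∙-cong (onlyAt-elsewhere _ (λ ιsi≡ι0 → 0≢1+n (≡.sym (ι-inj ιsi≡ι0))))
                    (∏singles-inside (ι ∘ suc) (suc-injective ∘ ι-inj) i))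
            (identityˡ _)

  -- (f , k) = (b , k) (a ∘ k , id)  with  f = b a  pointwise, and (a ∘ k , id) is a product of singles
  connection-generates : Generates W.rawGroup Connection
  connection-generates (f , k , k∈H) =
    (bs , k , k∈H) ∷ singles as id ,
    inj₁ (λ ω → bpart∈B (f ω)) ∷ singles-connection as (λ ω → apart∈A (f (k ⟨$⟩ʳ ω))) id ,
    (λ ω → trans (bpart∙apart (f ω)) (∙-congˡ (sym (as-coordinate ω)))) ,
    (λ i → ≡.cong (k ⟨$⟩ʳ_) (≡.sym (perm-∏singles as id i)))
    where
    bs as : Fin n → Carrier
    bs ω = bpart (f ω)
    as ω = apart (f (k ⟨$⟩ʳ ω))
    as-coordinate : ∀ ω → fn (∏ (singles as id)) (k ⟨$⟩ˡ ω) ≈ apart (f ω)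
    as-coordinate ω = trans (∏singles-inside as id id (k ⟨$⟩ˡ ω))
                            (reflexive (≡.cong (apart ∘ f) (Perm.inverseʳ k)))

  twist-homomorphic : IsCCAGroup (Wreath G H) → ∀ ω₀ x y → twist ω₀ (x W.∙ y) W.≈ twist ω₀ x W.∙ twist ω₀ y
  twist-homomorphic cca ω₀ = inGRAut∧fixes-ε⇒homomorphic W (twistPerm ω₀) inGRAut (twist-ε ω₀)
    where
    inGRAut : InGRAut W.rawGroup Connection (twistPerm ω₀)
    inGRAut = proj₁ (cca Connection (λ {x} {y} → connection-respects {x} {y}) (λ {s} → connection-inverseClosed {s})
                         connection-generates (twistPerm ω₀))
                    (twist-preservesColouredEdges ω₀ , twist-preservesColouredEdges ω₀)

  -- compare both sides of  twist ω₀ ((a , id) (1 , h))  at ω₀:  h moves ω₀, so only the right side inverts a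
  twist-homomorphic⇒a≈a⁻¹ : ∀ ω₀ {h} (h∈H : H.member h) → h ⟨$⟩ʳ ω₀ ≢ ω₀
                              → (∀ x y → twist ω₀ (x W.∙ y) W.≈ twist ω₀ x W.∙ twist ω₀ y)
                              → ∀ {a} → A.member a → a ≈ a ⁻¹
  twist-homomorphic⇒a≈a⁻¹ ω₀ {h} h∈H hω₀≢ω₀ hom {a} a∈A = begin
    a                                                         ≈⟨ identityʳ a ⟨
    a ∙ ε                                                     ≈⟨ invertAt-elsewhere (h ⟨$⟩ʳ ω₀) ω₀ (a ∙ ε) (hω₀≢ω₀ ∘ ≡.sym) ⟨
    invertAt (h ⟨$⟩ʳ ω₀) ω₀ (a ∙ ε)                           ≈⟨ proj₁ (hom x y) ω₀ ⟩
    invertAt ω₀ ω₀ a ∙ invertAt (h ⟨$⟩ʳ ω₀) ω₀ ε              ≈⟨ ∙-cong (invertAt-here ω₀ ω₀ a ≡.refl)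
                                                                        (invertAt-fixes (h ⟨$⟩ʳ ω₀) ω₀ (λ _ → invert-ε)) ⟩
    invert a ∙ ε                                              ≈⟨ identityʳ (invert a) ⟩
    invert a                                                  ≈⟨ invert-inverts-A a∈A ⟩
    a ⁻¹                                                      ∎
    where
    open SetoidReasoning setoid
    x y : W.Carrier
    x = (λ _ → a) , Perm.id , H.id-closed
    y = (λ _ → ε) , h , h∈H

  isCCA⇒A-annihilated-by-2 : IsCCAGroup (Wreath G H) → ∀ ω₀ {h} → H.member h → h ⟨$⟩ʳ ω₀ ≢ ω₀ → Annihilates G A 2
  isCCA⇒A-annihilated-by-2 cca ω₀ h∈H hω₀≢ω₀ {a} a∈A =
    trans (∙-congˡ (identityʳ a))
          (trans (∙-congˡ (twist-homomorphic⇒a≈a⁻¹ ω₀ h∈H hω₀≢ω₀ (twist-homomorphic cca ω₀) a∈A))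
                 (inverseʳ a))

corollary3p3 : (n : ℕ) (H : PermGroup n) → Nontrivial H
    → (G : Group 0ℓ 0ℓ) → FiniteGroup G
    → (A B : Subgroup G) → IsNormal G A → IsSemidirect G B A
    → IsAbelianSub G A → ExponentGreaterThan2 G A
    → NonCCA (Wreath G H)
corollary3p3 n H H≠1 G _ A B A◁G G≈B⋉A A-comm exp>2 cca = H≠1 fixes-everything
  where
  open WreathTwist H G A B A◁G G≈B⋉A A-comm
  fixes-everything : ∀ π → PermGroup.member H π → ∀ i → π ⟨$⟩ʳ i ≡ i
  fixes-everything π π∈H i with π ⟨$⟩ʳ i ≟ i
  ... | yes πi≡i = πi≡i
  ... | no πi≢i = ⊥-elim (exp>2 2 (s≤s z≤n) (s≤s (s≤s z≤n)) (isCCA⇒A-annihilated-by-2 cca i π∈H πi≢i))
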